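{- For all positive integers $b$, $k$ and $p$ there is a positive integer $f(b,k,p)$ such that the following holds. If $e_1, \dots, e_{f(b,k,p)}$ is a $k$-split-degenerate sequence of edges of a hypergraph that does not contain a matching of size $p$ (i.e. there are no $p$ indices $i_1<\dots<i_p$ with $e_{i_1},\dots,e_{i_p}$ pairwise disjoint), then there are integers $1 \leq a(1) < a(2) < \dots < a(b) \leq f(b,k,p)$ such that $e_{a(1)}, e_{a(2)}, \dots, e_{a(b)}$ is a $b$-bromeliad.
   Context: A hypergraph $\mathcal{H}$ consists of a finite vertex set $V(\mathcal{H})$ and a set of edges, each a subset of $V(\mathcal{H})$. For edges $e_1,\dots,e_L$ of $\mathcal{H}$, the regions $\mathcal{R}(e_1,\dots,e_L)$ are the non-empty sets of the form $\bigcap_{i \in I} e_i \cap \bigcap_{i \in [L]\setminus I}(V(\mathcal{H}) \setminus e_i)$ for $I \subseteq [L]$ (for $L=0$ the only region is $V(\mathcal{H})$, if non-empty). A sequence of edges $e_1,\dots,e_L$ is $k$-split-degenerate if for each $1 \le j \le L$, the edge $e_j$ intersects at most $k$ regions of $\mathcal{R}(e_1,\dots,e_{j-1})$ and contains no region of $\mathcal{R}(e_1,\dots,e_{j-1})$. A sequence of edges $(e_1,\dots,e_b)$ is a $b$-bromeliad if there are sets $C_i$ (cores) and $P_i$ (petals), $1 \le i \le b$, such that: for each $i$, $C_i$ and $P_i$ partition $e_i$ (i.e. $C_i \cap P_i = \emptyset$, $C_i \cup P_i = e_i$); $e_1 = C_1 \supsetneq C_2 \supsetneq \dots \supsetneq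 C_b \neq \emptyset$; and $P_1, \dots, P_b, C_1$ are pairwise disjoint. -}

module Defs where

open import Data.Nat using (ℕ; zero; suc; _≤_; _∸_)
open import Data.Fin using (Fin; Fin′; toℕ; inject; _<_)
open import Data.Fin.Subset using (Subset; _∈_; _∉_; _⊆_; _⊂_; _∩_; _∪_; ⊥; Nonempty)
open import Data.List using (List; length)
open import Data.List.Membership.Propositional using () renaming (_∈_ to _∈ₗ_)
open import Data.Product using (Σ; ∃; _×_)
open import Relation.Nullary using (¬_)
open import Relation.Binary.PropositionalEquality using (_≡_; _≢_)
open import Function.Bundles using (_⇔_)

InRegion : ∀ {n m} → (Fin m → Subset n) → Subset m → Fin n → Set
InRegion E I v = ∀ i → (v ∈ E i) ⇔ (i ∈ I)

IsRegion : ∀ {n m} → (Fin m → Subset n) → Subset m → Set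
IsRegion E I = ∃ λ v → InRegion E I v

RegionMeets : ∀ {n m} → (Fin m → Subset n) → Subset m → Subset n → Set
RegionMeets E I e = ∃ λ v → InRegion E I v × v ∈ e

RegionInside : ∀ {n m} → (Fin m → Subset n) → Subset m → Subset n → Set
RegionInside E I e = IsRegion E I × (∀ v → InRegion E I v → v ∈ e)

-- e intersects at most k regions of R(E): the set of index sets I whose region
-- meets e has at most k elements (it is covered by a list of length ≤ k).
-- (Distinct I give distinct regions, since regions are non-empty and disjoint.)
MeetsAtMost : ∀ {n m} → ℕ → (Fin m → Subset n) → Subset n → Set
MeetsAtMost {m = m} k E e =
  Σ (List (Subset m)) λ Is → length Is ≤ k × (∀ I → RegionMeets E I e → I ∈ₗ Is)

Prefix : ∀ {n L} → (Fin L → Subset n) → (j : Fin L) → Fin′ j → Subset n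
Prefix e j i = e (inject i)

SplitDegenerate : ∀ {n L} → ℕ → (Fin L → Subset n) → Set
SplitDegenerate k e =
  ∀ j → MeetsAtMost k (Prefix e j) (e j)
      × (∀ I → ¬ RegionInside (Prefix e j) I (e j))

Disjoint : ∀ {n} → Subset n → Subset n → Set
Disjoint A B = ∀ v → v ∈ A → v ∉ B

StrictlyIncreasing : ∀ {m L} → (Fin m → Fin L) → Set
StrictlyIncreasing a = ∀ i j → i < j → a i < a j

HasMatching : ∀ {n L} → ℕ → (Fin L → Subset n) → Set
HasMatching {L = L} p e =
  Σ (Fin p → Fin L) λ a → StrictlyIncreasing a
    × (∀ i j → i ≢ j → Disjoint (e (a i)) (e (a j)))

-- (e_1,…,e_b) is a b-bromeliad (index i : Fin b stands for i+1)
Bromeliad : ∀ {n} (b : ℕ) → (Fin b → Subset n) → Set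
Bromeliad {n} b e =
  Σ (Fin b → Subset n) λ C → Σ (Fin b → Subset n) λ P →
      (∀ i → Disjoint (C i) (P i))
    × (∀ i → C i ∪ P i ≡ e i)
    × (∀ i → toℕ i ≡ 0 → e i ≡ C i)
    × (∀ i j → toℕ j ≡ suc (toℕ i) → C j ⊂ C i)
    × (∀ i → toℕ i ≡ b ∸ 1 → Nonempty (C i))
    × (∀ i j → i ≢ j → Disjoint (P i) (P j))
    × (∀ i j → toℕ j ≡ 0 → Disjoint (P i) (C j))

-- Run through the edges from the last one backwards.  As e_t meets at most k regions of the earlier
-- edges, its vertices have at most k traces (patterns of membership in the earlier edges).
-- Keeping, for each trace in turn, the larger half of the remaining earlier edges on which that
-- trace is constant costs a factor 2^k, so f = T(b + p) edges, with T(L + 1) = 1 + 2^k T(L),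
-- contain a homogeneous subsequence of b + p edges: inside each of its edges, every vertex lies in
-- all or in none of the earlier ones.  In a homogeneous sequence the last edge is either disjoint
-- from all earlier edges or shares a vertex with one, hence with all of them; without a matching of
-- size p, fewer than p steps of the first kind leave b edges with a common vertex v.  With e₁ the
-- earliest of them, the cores eᵢ ∩ e₁ and petals eᵢ ∖ e₁ form a bromeliad: homogeneity gives all
-- inclusions and disjointness, and the cores shrink strictly because eᵢ ∩ e₁ contains the region of
-- v among the edges before e_{i+1}, which e_{i+1} may not contain.

{-# OPTIONS --safe #-}
module Submission where

open import Defs
open import Data.Nat using (ℕ; _≤_)
open import Data.Fin using (Fin)
open import Data.Fin.Subset using (Subset)
open import Data.Product using (Σ; _×_)
open import Function using (_∘_)
open import Relation.Nullary using (¬_)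

open import Data.Bool using (Bool; true; false; _≟_)
open import Data.Fin as Fin using (toℕ; fromℕ<; inject; opposite; _>_) renaming (_<_ to _<ᶠ_)
open import Data.Fin.Properties using (opposite-prop; toℕ<n; toℕ-inject; toℕ-fromℕ<; toℕ-injective; <-cmp)
open import Data.Fin.Subset as Subset using (_∈_; _∉_; _⊆_; _⊂_; _∩_; _∪_; ∁)
open import Data.Fin.Subset.Properties
  using (nonempty?; x∈p∩q⁺; x∈p∩q⁻; x∈∁p⇒x∉p; x∉∁p⇒x∈p; ∩-distribˡ-∪; ∪-inverseʳ; ∩-identityʳ; ∩-idem)
open import Data.List using (List; []; _∷_; length; lookup; filter; map; take; tabulate)
open import Data.List.Properties using (length-map; length-take; length-tabulate)
open import Data.List.Membership.Propositional using (find; lose)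
open import Data.List.Membership.Propositional.Properties using (∈-lookup)
open import Data.List.Relation.Binary.Sublist.Propositional using ([]; _∷_; _∷ʳ_; ⊆-refl; ⊆-trans; minimum)
  renaming (_⊆_ to _⊑_)
open import Data.List.Relation.Binary.Sublist.Propositional.Properties
  using (All-resp-⊆; Any-resp-⊆; filter-⊆; take-⊆)
open import Data.List.Relation.Unary.All as All using (All; []; _∷_)
open import Data.List.Relation.Unary.All.Properties using (all-filter; ¬Any⇒All¬)
open import Data.List.Relation.Unary.AllPairs using (AllPairs; []; _∷_)
open import Data.List.Relation.Unary.AllPairs.Properties using (tabulate⁺-<)
open import Data.List.Relation.Unary.Any as Any using (Any; any?)
open import Data.List.Relation.Unary.Any.Properties using (map⁺)
open import Data.Nat using (suc; zero; _+_; _*_; _^_; _∸_; z≤n; s≤s; s≤s⁻¹)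
open import Data.Nat.Properties
  using (+-suc; +-identityʳ; +-monoˡ-≤; +-monoʳ-≤; *-assoc; *-monoˡ-≤; *-monoʳ-≤; *-cancelˡ-≤;
         ^-monoʳ-≤; m^n≢0; ≤-total; ≤-reflexive; ≤-trans; ∸-monoʳ-<; m≤n+m; m+n≤o⇒m≤o; m≤n⇒m⊓n≡m; module ≤-Reasoning)
open import Data.Product as Product using (∃; _,_; proj₁; proj₂)
open import Data.Sum using (_⊎_; inj₁; inj₂)
open import Data.Unit using (⊤; tt)
open import Data.Vec using () renaming (lookup to vlookup; tabulate to vtabulate)
open import Data.Vec.Properties using ([]=⇒lookup; lookup⇒[]=; lookup∘tabulate)
open import Function.Bundles using (_⇔_; mk⇔; Equivalence)
open import Function.Construct.Composition using (_⇔-∘_)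
open import Function.Construct.Symmetry using (⇔-sym)
open import Relation.Binary using (Rel; tri<; tri≈; tri>)
open import Relation.Binary.PropositionalEquality
  using (_≡_; _≢_; refl; sym; trans; cong; subst; module ≡-Reasoning)
open import Relation.Nullary using (yes; no; contradiction)

module _ {a r} {A : Set a} {R : Rel A r} where

  AllPairs-resp-⊑ : ∀ {xs ys} → xs ⊑ ys → AllPairs R ys → AllPairs R xs
  AllPairs-resp-⊑ []         []         = []
  AllPairs-resp-⊑ (_ ∷ʳ τ)   (_ ∷ rys)  = AllPairs-resp-⊑ τ rys
  AllPairs-resp-⊑ (refl ∷ τ) (ry ∷ rys) = All-resp-⊆ τ ry ∷ AllPairs-resp-⊑ τ rys

  AllPairs-lookup : ∀ {xs} → AllPairs R xs → ∀ {i j} → i <ᶠ j → R (lookup xs i) (lookup xs j)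
  AllPairs-lookup (rx ∷ _)  {Fin.zero}  {Fin.suc j} _         = All.lookup rx (∈-lookup j)
  AllPairs-lookup (_ ∷ rxs) {Fin.suc i} {Fin.suc j} (s≤s i<j) = AllPairs-lookup rxs i<j

module _ {a} {A : Set a} where

  Constant : (A → Bool) → List A → Set a
  Constant Q xs = ∃ λ c → All (λ x → Q x ≡ c) xs

  fibre : (A → Bool) → Bool → List A → List A
  fibre Q c = filter (λ x → Q x ≟ c)

  length-fibres : ∀ Q xs → length xs ≡ length (fibre Q true xs) + length (fibre Q false xs)
  length-fibres Q []       = refl
  length-fibres Q (x ∷ xs) with Q x
  ... | true  = cong suc (length-fibres Q xs)
  ... | false = trans (cong suc (length-fibres Q xs)) (sym (+-suc _ _))

  halve : (Q : A → Bool) (xs : List A) → ∃ λ ys → ys ⊑ xs × Constant Q ys × length xs ≤ 2 * length ys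
  halve Q xs = larger (≤-total (length yes-fibre) (length no-fibre))
    where
    yes-fibre no-fibre : List A
    yes-fibre = fibre Q true xs
    no-fibre  = fibre Q false xs

    open ≤-Reasoning
    bound : ∀ m → length yes-fibre + length no-fibre ≤ m + m → length xs ≤ 2 * m
    bound m h = begin
      length xs                           ≡⟨ length-fibres Q xs ⟩
      length yes-fibre + length no-fibre  ≤⟨ h ⟩
      m + m                               ≡⟨ cong (m +_) (sym (+-identityʳ m)) ⟩
      2 * m                               ∎

    larger : length yes-fibre ≤ length no-fibre ⊎ length no-fibre ≤ length yes-fibre →
             ∃ λ ys → ys ⊑ xs × Constant Q ys × length xs ≤ 2 * length ys
    larger (inj₁ y≤n) = no-fibre  , filter-⊆ _ xs , (false , all-filter _ xs) ,
                        bound (length no-fibre) (+-monoˡ-≤ (length no-fibre) y≤n)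
    larger (inj₂ n≤y) = yes-fibre , filter-⊆ _ xs , (true  , all-filter _ xs) ,
                        bound (length yes-fibre) (+-monoʳ-≤ (length yes-fibre) n≤y)

  refine : (Qs : List (A → Bool)) (xs : List A) →
           ∃ λ ys → ys ⊑ xs × All (λ Q → Constant Q ys) Qs × length xs ≤ 2 ^ length Qs * length ys
  refine []       xs = xs , ⊆-refl , [] , ≤-reflexive (sym (+-identityʳ _))
  refine (Q ∷ Qs) xs =
    let ys , ys⊑xs , Q-constant  , xs≤ys = halve Q xs
        zs , zs⊑ys , Qs-constant , ys≤zs = refine Qs ys
    in zs , ⊆-trans zs⊑ys ys⊑xs , Product.map₂ (All-resp-⊆ zs⊑ys) Q-constant ∷ Qs-constant ,
       (begin
         length xs                        ≤⟨ xs≤ys ⟩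
         2 * length ys                    ≤⟨ *-monoʳ-≤ 2 ys≤zs ⟩
         2 * (2 ^ length Qs * length zs)  ≡⟨ sym (*-assoc 2 (2 ^ length Qs) (length zs)) ⟩
         2 ^ length (Q ∷ Qs) * length zs  ∎)
    where open ≤-Reasoning

opposite-< : ∀ {m} {i j : Fin m} → i <ᶠ j → opposite j <ᶠ opposite i
opposite-< {m} {i} {j} i<j = begin-strict
  toℕ (opposite j)  ≡⟨ opposite-prop j ⟩
  m ∸ suc (toℕ j)   <⟨ ∸-monoʳ-< (s≤s i<j) (toℕ<n j) ⟩
  m ∸ suc (toℕ i)   ≡⟨ opposite-prop i ⟨
  toℕ (opposite i)  ∎
  where open ≤-Reasoning

inject-fromℕ< : ∀ {m} {i j : Fin m} (j<i : j <ᶠ i) → inject {i = i} (fromℕ< j<i) ≡ j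
inject-fromℕ< j<i = toℕ-injective (trans (toℕ-inject _) (toℕ-fromℕ< j<i))

-- Subsequences are chosen from the last edge backwards, so they are kept as lists of indices in
-- decreasing order and enumerated in reverse at the end.
Decreasing : ∀ {f} → List (Fin f) → Set
Decreasing = AllPairs _>_

decreasing-opposites : ∀ f → Decreasing (tabulate (opposite {f}))
decreasing-opposites f = tabulate⁺-< opposite-<

enumerate : ∀ {a} {A : Set a} (xs : List A) → Fin (length xs) → A
enumerate xs = lookup xs ∘ opposite

enumerate-AllPairs : ∀ {a r} {A : Set a} {R : Rel A r} {xs} → AllPairs R xs →
                     ∀ {i j} → i <ᶠ j → R (enumerate xs j) (enumerate xs i)
enumerate-AllPairs rxs = AllPairs-lookup rxs ∘ opposite-<

enumerate-increasing : ∀ {f} {xs : List (Fin f)} → Decreasing xs → StrictlyIncreasing (enumerate xs)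
enumerate-increasing dec _ _ = enumerate-AllPairs dec

module _ {n : ℕ} where

  ∈⇔lookup≡true : ∀ {x : Fin n} {p} → x ∈ p ⇔ vlookup p x ≡ true
  ∈⇔lookup≡true {x} {p} = mk⇔ []=⇒lookup (lookup⇒[]= x p)

  ∈-tabulate : ∀ {g : Fin n → Bool} {x} → x ∈ vtabulate g ⇔ g x ≡ true
  ∈-tabulate {g} {x} = mk⇔
    (trans (sym (lookup∘tabulate g x)) ∘ Equivalence.to ∈⇔lookup≡true)
    (Equivalence.from ∈⇔lookup≡true ∘ trans (lookup∘tabulate g x))

  ⊈⇒∃∖ : {p q : Subset n} → ¬ p ⊆ q → ∃ λ x → x ∈ p × x ∉ q
  ⊈⇒∃∖ {p} {q} p⊈q with nonempty? (p ∩ ∁ q)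
  ... | yes (x , x∈p∖q) = x , Product.map₂ x∈∁p⇒x∉p (x∈p∩q⁻ p (∁ q) x∈p∖q)
  ... | no  p∖q-empty   =
    contradiction (λ {x} x∈p → x∉∁p⇒x∈p λ x∈∁q → p∖q-empty (x , x∈p∩q⁺ (x∈p , x∈∁q))) p⊈q

  ∩-∁-disjoint : ∀ (p q : Subset n) → Disjoint (p ∩ q) (p ∩ ∁ q)
  ∩-∁-disjoint p q x x∈p∩q x∈p∖q = x∈∁p⇒x∉p (proj₂ (x∈p∩q⁻ p (∁ q) x∈p∖q)) (proj₂ (x∈p∩q⁻ p q x∈p∩q))

  ∩-∪-∩-∁ : ∀ (p q : Subset n) → (p ∩ q) ∪ (p ∩ ∁ q) ≡ p
  ∩-∪-∩-∁ p q = begin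
    (p ∩ q) ∪ (p ∩ ∁ q)  ≡⟨ ∩-distribˡ-∪ p q (∁ q) ⟨
    p ∩ (q ∪ ∁ q)        ≡⟨ cong (p ∩_) (∪-inverseʳ q) ⟩
    p ∩ Subset.⊤         ≡⟨ ∩-identityʳ p ⟩
    p                    ∎
    where open ≡-Reasoning

homogeneityBound : ℕ → ℕ → ℕ
homogeneityBound k zero    = 0
homogeneityBound k (suc L) = suc (2 ^ k * homogeneityBound k L)

module _ {n f : ℕ} (e : Fin f → Subset n) where

  column : Fin n → Fin f → Bool
  column v j = vlookup (e j) v

  regionOf : (t : Fin f) → Fin n → Subset (toℕ t)
  regionOf t v = vtabulate (column v ∘ inject)

  inRegionOf : ∀ t v → InRegion (Prefix e t) (regionOf t v) v
  inRegionOf t v i = ⇔-sym ∈-tabulate ⇔-∘ ∈⇔lookup≡true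

  trace : (t : Fin f) → Subset (toℕ t) → Fin f → Bool
  trace t I j with j Fin.<? t
  ... | yes j<t = vlookup I (fromℕ< j<t)
  ... | no  _   = false

  AgreesBelow : Fin f → (Fin f → Bool) → (Fin f → Bool) → Set
  AgreesBelow t Q Q′ = ∀ {j} → j <ᶠ t → Q j ≡ Q′ j

  trace-regionOf : ∀ t v → AgreesBelow t (trace t (regionOf t v)) (column v)
  trace-regionOf t v {j} j<t with j Fin.<? t
  ... | no  j≮t = contradiction j<t j≮t
  ... | yes j<t = begin
    vlookup (regionOf t v) (fromℕ< j<t)  ≡⟨ lookup∘tabulate _ (fromℕ< j<t) ⟩
    column v (inject (fromℕ< j<t))       ≡⟨ cong (column v) (inject-fromℕ< j<t) ⟩
    column v j                           ∎
    where open ≡-Reasoning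

  FewTraces : ℕ → Set
  FewTraces k = ∀ t → ∃ λ Qs → length Qs ≤ k × (∀ {v} → v ∈ e t → Any (λ Q → AgreesBelow t Q (column v)) Qs)

  splitDegenerate⇒fewTraces : ∀ {k} → SplitDegenerate k e → FewTraces k
  splitDegenerate⇒fewTraces deg t =
    let (Is , |Is|≤k , meets) , _ = deg t
    in map (trace t) Is , ≤-trans (≤-reflexive (length-map (trace t) Is)) |Is|≤k ,
       λ {v} v∈t → map⁺ (Any.map (λ { refl {j} → trace-regionOf t v {j} })
                                 (meets (regionOf t v) (v , inRegionOf t v , v∈t)))

  AllOrNone : Fin n → List (Fin f) → Set
  AllOrNone v S = Any (λ s → v ∈ e s) S → All (λ s → v ∈ e s) S

  Homogeneous : List (Fin f) → Set
  Homogeneous []      = ⊤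
  Homogeneous (t ∷ S) = (∀ {v} → v ∈ e t → AllOrNone v S) × Homogeneous S

  Homogeneous-resp-⊑ : ∀ {S S′} → S ⊑ S′ → Homogeneous S′ → Homogeneous S
  Homogeneous-resp-⊑ []         _          = tt
  Homogeneous-resp-⊑ (_ ∷ʳ τ)   (_  , hom) = Homogeneous-resp-⊑ τ hom
  Homogeneous-resp-⊑ (refl ∷ τ) (h₀ , hom) =
    (λ v∈t → All-resp-⊆ τ ∘ h₀ v∈t ∘ Any-resp-⊆ τ) , Homogeneous-resp-⊑ τ hom

  constantColumn⇒allOrNone : ∀ {v S} → Constant (column v) S → AllOrNone v S
  constantColumn⇒allOrNone (c , cols≡c) v∈some =
    let colₛ≡c , v∈s = All.lookupAny cols≡c v∈some
        c≡true       = trans (sym colₛ≡c) (Equivalence.to ∈⇔lookup≡true v∈s)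
    in All.map (λ col≡c → Equivalence.from ∈⇔lookup≡true (trans col≡c c≡true)) cols≡c

  allOrNone-below : ∀ {t Q v S} → All (t >_) S → AgreesBelow t Q (column v) → Constant Q S → AllOrNone v S
  allOrNone-below S<t agrees (c , Q≡c) =
    constantColumn⇒allOrNone (c , All.zipWith (λ (s<t , Qs≡c) → trans (sym (agrees s<t)) Qs≡c) (S<t , Q≡c))

  homogeneous-sublist : ∀ {k} → FewTraces k → ∀ L xs → Decreasing xs → homogeneityBound k L ≤ length xs →
                        ∃ λ S → S ⊑ xs × length S ≡ L × Homogeneous S
  homogeneous-sublist traces zero    xs       _               _           = [] , minimum xs , refl , tt
  homogeneous-sublist {k} traces (suc L) (t ∷ ys) (ys<t ∷ ys-dec) (s≤s bound) =
    let Qs , |Qs|≤k , traced          = traces t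
        zs , zs⊑ys , constant , ys≤zs = refine Qs ys
        S , S⊑zs , |S|≡L , hom        = homogeneous-sublist traces L zs (AllPairs-resp-⊑ zs⊑ys ys-dec)
                                                            (enough zs |Qs|≤k ys≤zs)
        head : ∀ {v} → v ∈ e t → AllOrNone v S
        head v∈t = let Q-constant , agrees = All.lookupAny constant (traced v∈t)
                   in allOrNone-below (All-resp-⊆ (⊆-trans S⊑zs zs⊑ys) ys<t) agrees
                                      (Product.map₂ (All-resp-⊆ S⊑zs) Q-constant)
    in t ∷ S , refl ∷ ⊆-trans S⊑zs zs⊑ys , cong suc |S|≡L , head , hom
    where
    enough : ∀ {l} zs → l ≤ k → length ys ≤ 2 ^ l * length zs → homogeneityBound k L ≤ length zs
    enough {l} zs l≤k ys≤zs = *-cancelˡ-≤ (2 ^ k) {{m^n≢0 2 k}} (begin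
      2 ^ k * homogeneityBound k L  ≤⟨ bound ⟩
      length ys                     ≤⟨ ys≤zs ⟩
      2 ^ l * length zs             ≤⟨ *-monoˡ-≤ (length zs) (^-monoʳ-≤ 2 l≤k) ⟩
      2 ^ k * length zs             ∎)
      where open ≤-Reasoning

  homogeneous-lookup : ∀ {S} → Homogeneous S → ∀ {p q r} → p <ᶠ q → p <ᶠ r →
                       ∀ {x} → x ∈ e (lookup S p) → x ∈ e (lookup S q) → x ∈ e (lookup S r)
  homogeneous-lookup {_ ∷ S} (h₀ , _) {Fin.zero} {Fin.suc q} {Fin.suc r} _ _ x∈t x∈q =
    All.lookup (h₀ x∈t (lose (∈-lookup q) x∈q)) (∈-lookup r)
  homogeneous-lookup {_ ∷ S} (_ , hom) {Fin.suc p} {Fin.suc q} {Fin.suc r} (s≤s p<q) (s≤s p<r) =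
    homogeneous-lookup hom p<q p<r

  Matching : List (Fin f) → Set
  Matching = AllPairs (λ s t → Disjoint (e s) (e t))

  CommonVertex : List (Fin f) → Set
  CommonVertex S = ∃ λ v → All (λ s → v ∈ e s) S

  disjoint-or-commonVertex : ∀ {t S} → Homogeneous (t ∷ S) →
                             All (λ s → Disjoint (e t) (e s)) S ⊎ CommonVertex (t ∷ S)
  disjoint-or-commonVertex {t} {S} (h₀ , _) with any? (λ s → nonempty? (e t ∩ e s)) S
  ... | yes meets =
    let s , s∈S , v , v∈t∩s = find meets
        v∈t , v∈s          = x∈p∩q⁻ (e t) (e s) v∈t∩s
    in inj₂ (v , v∈t ∷ h₀ v∈t (lose s∈S v∈s))
  ... | no ¬meets =
    inj₁ (All.map (λ t∩s-empty x x∈t x∈s → t∩s-empty (x , x∈p∩q⁺ (x∈t , x∈s))) (¬Any⇒All¬ S ¬meets))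

  matching-or-commonVertex : ∀ b q S → Homogeneous S → b + q ≤ length S →
                             (∃ λ M → M ⊑ S × length M ≡ q × Matching M) ⊎
                             (∃ λ B → B ⊑ S × b ≤ length B × CommonVertex B)
  matching-or-commonVertex b zero    S       _   _     = inj₁ ([] , minimum S , refl , [])
  matching-or-commonVertex b (suc q) []      _   b+q≤0 = contradiction (≤-trans (m≤n+m (suc q) b) b+q≤0) λ ()
  matching-or-commonVertex b (suc q) (t ∷ S) hom b+q≤ with disjoint-or-commonVertex hom
  ... | inj₂ common     = inj₂ (t ∷ S , ⊆-refl , m+n≤o⇒m≤o b b+q≤ , common)
  ... | inj₁ t-disjoint
    with matching-or-commonVertex b q S (proj₂ hom) (s≤s⁻¹ (subst (_≤ suc (length S)) (+-suc b q) b+q≤))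
  ...   | inj₁ (M , M⊑S , |M|≡q , matching) =
    inj₁ (t ∷ M , refl ∷ M⊑S , cong suc |M|≡q , All-resp-⊆ M⊑S t-disjoint ∷ matching)
  ...   | inj₂ (B , B⊑S , b≤|B| , common) = inj₂ (B , t ∷ʳ B⊑S , b≤|B| , common)

  matching⇒hasMatching : ∀ {M} → Decreasing M → Matching M → HasMatching (length M) e
  matching⇒hasMatching {M} dec matching = enumerate M , enumerate-increasing dec , disjoint
    where
    disjoint : ∀ i j → i ≢ j → Disjoint (e (enumerate M i)) (e (enumerate M j))
    disjoint i j i≢j with <-cmp i j
    ... | tri< i<j _ _ = λ x x∈i x∈j → enumerate-AllPairs matching i<j x x∈j x∈i
    ... | tri≈ _ i≡j _ = contradiction i≡j i≢j
    ... | tri> _ _ j<i = enumerate-AllPairs matching j<i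

  NoRegionInside : Set
  NoRegionInside = ∀ t I → ¬ RegionInside (Prefix e t) I (e t)

  sameRegion-∈ : ∀ {t v w x} → InRegion (Prefix e t) (regionOf t v) w → x <ᶠ t → v ∈ e x → w ∈ e x
  sameRegion-∈ {t} {v} {w} w∈R x<t =
    subst (λ y → v ∈ e y → w ∈ e y) (inject-fromℕ< x<t) (Equivalence.to (⇔-sym (w∈R i) ⇔-∘ inRegionOf t v i))
    where
    i : Fin (toℕ t)
    i = fromℕ< x<t

  -- e x ∩ e y contains the whole region of v among the edges before t.
  earlier-∩-⊈ : NoRegionInside → ∀ {t x y v} → x <ᶠ t → y <ᶠ t → v ∈ e x → v ∈ e y → ¬ e x ∩ e y ⊆ e t
  earlier-∩-⊈ noInside {t} {v = v} x<t y<t v∈x v∈y x∩y⊆t =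
    noInside t (regionOf t v)
      ((v , inRegionOf t v) , λ w w∈R → x∩y⊆t (x∈p∩q⁺ (sameRegion-∈ w∈R x<t v∈x , sameRegion-∈ w∈R y<t v∈y)))

  BromeliadIn : ℕ → Set
  BromeliadIn b = Σ (Fin b → Fin f) λ a → StrictlyIncreasing a × Bromeliad b (e ∘ a)

  module _ (noInside : NoRegionInside) {m} (a : Fin (suc m) → Fin f) (increasing : StrictlyIncreasing a)
           (hom : ∀ {i j t} → i <ᶠ t → j <ᶠ t → ∀ {x} → x ∈ e (a t) → x ∈ e (a i) → x ∈ e (a j))
           {v} (common : ∀ i → v ∈ e (a i)) where

    base : Subset n
    base = e (a Fin.zero)

    core petal : Fin (suc m) → Subset n
    core  i = e (a i) ∩ base
    petal i = e (a i) ∩ ∁ base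

    zero< : ∀ {i j : Fin (suc m)} → i <ᶠ j → Fin.zero {m} <ᶠ j
    zero< i<j = ≤-trans (s≤s z≤n) i<j

    core-⊂ : ∀ {i j} → i <ᶠ j → core j ⊂ core i
    core-⊂ {i} {j} i<j = core-⊆ , escape
      where
      core-⊆ : core j ⊆ core i
      core-⊆ x∈cj = let x∈j , x∈0 = x∈p∩q⁻ _ _ x∈cj in x∈p∩q⁺ (hom (zero< i<j) i<j x∈j x∈0 , x∈0)
      escape : ∃ λ x → x ∈ core i × x ∉ core j
      escape =
        let x , x∈ci , x∉j = ⊈⇒∃∖ (earlier-∩-⊈ noInside (increasing i j i<j)
                                    (increasing Fin.zero j (zero< i<j)) (common i) (common Fin.zero))
        in x , x∈ci , x∉j ∘ proj₁ ∘ x∈p∩q⁻ _ _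

    petals-disjoint : ∀ {i j} → i <ᶠ j → Disjoint (petal i) (petal j)
    petals-disjoint i<j x x∈pi x∈pj =
      let x∈i , x∉0 = x∈p∩q⁻ _ _ x∈pi
          x∈j , _   = x∈p∩q⁻ _ _ x∈pj
      in x∈∁p⇒x∉p x∉0 (hom i<j (zero< i<j) x∈j x∈i)

    homogeneous⇒bromeliad : Bromeliad (suc m) (e ∘ a)
    homogeneous⇒bromeliad =
      core , petal , (λ i → ∩-∁-disjoint (e (a i)) base) , (λ i → ∩-∪-∩-∁ (e (a i)) base) , base-core ,
      (λ i j j≡1+i → core-⊂ (≤-reflexive (sym j≡1+i))) , (λ i _ → v , x∈p∩q⁺ (common i , common Fin.zero)) ,
      petals-disjoint′ , petal-base
      where
      base-core : ∀ i → toℕ i ≡ 0 → e (a i) ≡ core i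
      base-core Fin.zero _ = sym (∩-idem base)
      petals-disjoint′ : ∀ i j → i ≢ j → Disjoint (petal i) (petal j)
      petals-disjoint′ i j i≢j with <-cmp i j
      ... | tri< i<j _ _ = petals-disjoint i<j
      ... | tri≈ _ i≡j _ = contradiction i≡j i≢j
      ... | tri> _ _ j<i = λ x x∈i x∈j → petals-disjoint j<i x x∈j x∈i
      petal-base : ∀ i j → toℕ j ≡ 0 → Disjoint (petal i) (core j)
      petal-base i Fin.zero _ x x∈pi x∈c0 = x∈∁p⇒x∉p (proj₂ (x∈p∩q⁻ _ _ x∈pi)) (proj₂ (x∈p∩q⁻ _ _ x∈c0))

  commonVertex⇒bromeliad : NoRegionInside → ∀ b B → suc b ≤ length B →
                           Decreasing B → Homogeneous B → CommonVertex B → BromeliadIn (suc b)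
  commonVertex⇒bromeliad noInside b (t ∷ B) (s≤s b≤|B|) dec hom (v , common) =
    subst BromeliadIn (cong suc (trans (length-take b B) (m≤n⇒m⊓n≡m b≤|B|)))
      (a , a-increasing , homogeneous⇒bromeliad noInside a a-increasing
         (λ i<t j<t → homogeneous-lookup (Homogeneous-resp-⊑ prefix hom) (opposite-< i<t) (opposite-< j<t))
         (λ i → All.lookup (All-resp-⊆ prefix common) (∈-lookup (opposite i))))
    where
    prefix : t ∷ take b B ⊑ t ∷ B
    prefix = take-⊆ (suc b) (t ∷ B)
    a : Fin (length (t ∷ take b B)) → Fin f
    a = enumerate (t ∷ take b B)
    a-increasing : StrictlyIncreasing a
    a-increasing = enumerate-increasing (AllPairs-resp-⊑ prefix dec)

lemma3p2 : (b k p : ℕ) → 1 ≤ b → 1 ≤ k → 1 ≤ p →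
    Σ ℕ λ f → 1 ≤ f ×
      ((n : ℕ) (e : Fin f → Subset n) →
        SplitDegenerate k e → ¬ HasMatching p e →
        Σ (Fin b → Fin f) λ a → StrictlyIncreasing a × Bromeliad b (e ∘ a))
lemma3p2 (suc b) k p _ _ _ = f , s≤s z≤n , find-bromeliad
  where
  f : ℕ
  f = homogeneityBound k (suc b + p)

  all-indices : List (Fin f)
  all-indices = tabulate (opposite {f})

  decreasing : ∀ {T} → T ⊑ all-indices → Decreasing T
  decreasing T⊑all = AllPairs-resp-⊑ T⊑all (decreasing-opposites f)

  find-bromeliad : (n : ℕ) (e : Fin f → Subset n) → SplitDegenerate k e → ¬ HasMatching p e →
                   BromeliadIn e (suc b)
  find-bromeliad n e deg no-matching
    with S , S⊑all , |S|≡b+p , hom ← homogeneous-sublist e (splitDegenerate⇒fewTraces e deg) (suc b + p)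
                                       all-indices (decreasing-opposites f) (≤-reflexive (sym (length-tabulate opposite)))
    with matching-or-commonVertex e (suc b) p S hom (≤-reflexive (sym |S|≡b+p))
  ... | inj₁ (M , M⊑S , |M|≡p , matching) =
    contradiction (subst (λ q → HasMatching q e) |M|≡p
                     (matching⇒hasMatching e (decreasing (⊆-trans M⊑S S⊑all)) matching))
                  no-matching
  ... | inj₂ (B , B⊑S , b<|B| , common) =
    commonVertex⇒bromeliad e (proj₂ ∘ deg) b B b<|B|
      (decreasing (⊆-trans B⊑S S⊑all)) (Homogeneous-resp-⊑ e B⊑S hom) common
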